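{- For every $n\geq1$, the sum of the coefficients of the non-commutative polynomial $\hat\Phi_n(\mathbf c,-\mathbf d)=\Phi_n(\mathbf c,\mathbf c^2+\mathbf d)$ equals $|\mathcal R_n|$.
   Context: For $S\subseteq[n-1]$ let $u_S=u_1\cdots u_{n-1}$ with $u_i=\mathbf a$ if $i\notin S$, $u_i=\mathbf b$ if $i\in S$ (non-commuting variables). Let $\beta_n(S)$ be the number of $\sigma\in\mathfrak S_n$ with descent set $\{i:\sigma_i>\sigma_{i+1}\}=S$ and $\Psi_n(\mathbf a,\mathbf b)=\sum_S\beta_n(S)u_S$. The $cd$-index $\Phi_n(\mathbf c,\mathbf d)$ of the Boolean algebra $B_n$ is the (known to exist, unique) polynomial in non-commuting $\mathbf c,\mathbf d$ with $\Psi_n(\mathbf a,\mathbf b)=\Phi_n(\mathbf a+\mathbf b,\mathbf a\mathbf b+\mathbf b\mathbf a)$. Define $\hat\Phi_n(\mathbf c,\mathbf d)=\Phi_n(\mathbf c,\mathbf c^2-\mathbf d)$. $\mathcal R_n$ is the set of permutations $\sigma\in\mathfrak S_n$ with no consecutive descents (no $i$ with $\sigma_i>\sigma_{i+1}>\sigma_{i+2}$) and not ending with a descent (not $\sigma_{n-1}>\sigma_n$). -}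

module Defs where

open import Data.Nat using (ℕ; zero; suc; _<ᵇ_)
open import Data.Bool using (Bool; true; false; if_then_else_; _∧_; not)
open import Data.Integer using (ℤ; +_; _*_; _+_)
open import Data.Fin using (Fin; toℕ)
import Data.Fin.Properties as FinP
open import Data.Vec using (Vec; []; _∷_; toList)
open import Data.List using (List; []; _∷_; _++_; map; concatMap; filter; length; allFin; foldr)
open import Data.Product using (_×_; _,_)
open import Relation.Nullary using (Dec; yes; no)
open import Relation.Binary.PropositionalEquality using (_≡_; refl)
open import Relation.Nullary.Decidable using (does)
import Data.List.Properties as ListP
import Data.List.Relation.Unary.Unique.DecPropositional as UDP

-- Non-commutative polynomials over ℤ in variables from an alphabet A,
-- represented as formal sums (lists) of terms  k · w  (k ∈ ℤ, w a word).

Poly : Set → Set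
Poly A = List (ℤ × List A)

_·_ : {A : Set} → Poly A → Poly A → Poly A
p · q = concatMap (λ { (k , v) → map (λ { (l , w) → (k * l , v ++ w) }) q }) p

one : {A : Set} → Poly A
one = (+ 1 , []) ∷ []

substWord : {A B : Set} → (A → Poly B) → List A → Poly B
substWord σ = foldr (λ x acc → σ x · acc) one

subst : {A B : Set} → (A → Poly B) → Poly A → Poly B
subst σ = concatMap (λ { (k , w) → map (λ { (l , v) → (k * l , v) }) (substWord σ w) })

coeff : {A : Set} → ((x y : List A) → Dec (x ≡ y)) → Poly A → List A → ℤ
coeff eq [] u = + 0
coeff eq ((k , w) ∷ p) u with eq w u
... | yes _ = k + coeff eq p u
... | no _  = coeff eq p u

coeffSum : {A : Set} → Poly A → ℤ
coeffSum [] = + 0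
coeffSum ((k , _) ∷ p) = k + coeffSum p

data AB : Set where
  𝐚 𝐛 : AB

data CD : Set where
  𝐜 𝐝 : CD

_≟AB_ : (x y : AB) → Dec (x ≡ y)
𝐚 ≟AB 𝐚 = yes refl
𝐚 ≟AB 𝐛 = no (λ ())
𝐛 ≟AB 𝐚 = no (λ ())
𝐛 ≟AB 𝐛 = yes refl

_≟ABw_ : (x y : List AB) → Dec (x ≡ y)
_≟ABw_ = ListP.≡-dec _≟AB_

var : {A : Set} → A → Poly A
var x = (+ 1 , x ∷ []) ∷ []

abSub : CD → Poly AB
abSub 𝐜 = (+ 1 , 𝐚 ∷ []) ∷ (+ 1 , 𝐛 ∷ []) ∷ []
abSub 𝐝 = (+ 1 , 𝐚 ∷ 𝐛 ∷ []) ∷ (+ 1 , 𝐛 ∷ 𝐚 ∷ []) ∷ []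

-- c ↦ c ,  d ↦ c² + d     (so that subst hatMinusSub Φ = Φ(c, c² + d) = Φ̂(c, -d))
hatMinusSub : CD → Poly CD
hatMinusSub 𝐜 = var 𝐜
hatMinusSub 𝐝 = (+ 1 , 𝐜 ∷ 𝐜 ∷ []) ∷ (+ 1 , 𝐝 ∷ []) ∷ []

-- Permutations of [n] as injective maps, i.e. vectors (σ₁,…,σₙ) over Fin n
-- with pairwise distinct entries.

allVecs : (n k : ℕ) → List (Vec (Fin n) k)
allVecs n zero = [] ∷ []
allVecs n (suc k) = concatMap (λ i → map (i ∷_) (allVecs n k)) (allFin n)

perms : (n : ℕ) → List (Vec (Fin n) n)
perms n = filter (λ σ → UDP.unique? (FinP._≟_ {n}) (toList σ)) (allVecs n n)

descWord : List ℕ → List AB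
descWord (x ∷ y ∷ r) = (if y <ᵇ x then 𝐛 else 𝐚) ∷ descWord (y ∷ r)
descWord _ = []

permList : {n : ℕ} → Vec (Fin n) n → List ℕ
permList σ = map toℕ (toList σ)

-- β-coefficient: number of σ ∈ 𝔖ₙ whose descent word is u
-- (this is the coefficient of u in Ψₙ(a,b); it is 0 unless |u| = n-1)
βword : (n : ℕ) → List AB → ℕ
βword n u = length (filter (λ σ → descWord (permList σ) ≟ABw u) (perms n))

-- Φ is a cd-index of Bₙ:  Ψₙ(a,b) = Φ(a+b, ab+ba)
IsCdIndex : ℕ → Poly CD → Set
IsCdIndex n Φ = ∀ (u : List AB) → coeff _≟ABw_ (subst abSub Φ) u ≡ + βword n u

noDoubleDescent : List ℕ → Bool
noDoubleDescent (x ∷ y ∷ z ∷ r) = not ((y <ᵇ x) ∧ (z <ᵇ y)) ∧ noDoubleDescent (y ∷ z ∷ r)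
noDoubleDescent _ = true

notEndingInDescent : List ℕ → Bool
notEndingInDescent (x ∷ y ∷ []) = not (y <ᵇ x)
notEndingInDescent (x ∷ y ∷ z ∷ r) = notEndingInDescent (y ∷ z ∷ r)
notEndingInDescent _ = true

isR : List ℕ → Bool
isR s = noDoubleDescent s ∧ notEndingInDescent s

Rcount : ℕ → ℕ
Rcount n = length (filter (λ σ → isR (permList σ) Data.Bool.≟ true) (perms n))

module Submission where

-- Evaluate at the sixth root of unity ω (ω² = ω − 1) and its conjugate ω̄ = 1 − ω.
-- Since ω + ω̄ = 1 and ωω̄ + ω̄ω = 2, the coefficient sum of Φ(c, c² + d), i.e. its value at
-- c = 1, d = 2, equals the value of Ψₙ(a, b) = Φ(a + b, ab + ba) at a = ω, b = ω̄, which by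
-- the cd-index hypothesis is  ∑_σ L(Des σ)  with L(u) = u(ω, ω̄)  (Ψ-value).  Hence it remains
-- to show  ∑_σ L(Des σ) = ∑_σ K(Des σ),  where K is the indicator of the descent words of 𝓡ₙ.
--
-- Permutations are then enumerated by repeatedly inserting a new minimum,
-- which acts on descent words by an explicit operator (insertMin).  Sorting permutations by
-- the position of their minimum splits a descent word as x·ba·y; a Leibniz rule for
-- insertMin turns this into a binomial convolution (descentSum-split).  Both L and K are
-- multiplicative across the junction ba (ω̄ω = 1), so by strong induction the two sums agree
-- up to boundary terms, which are antisymmetric and cancel by symmetry of the binomial
-- coefficients (L≡K).

open import Defs

open import Algebra.Bundles using (CommutativeRing)
import Algebra.Properties.AbelianGroup as AbelianGroupProps
import Algebra.Properties.CommutativeSemigroup as CommSemigroupProps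
import Algebra.Solver.CommutativeMonoid as CommMonoidSolver
open import Data.Bool using (Bool; true; false; if_then_else_; _∧_)
import Data.Bool.Properties as Bool
open import Data.Empty using (⊥; ⊥-elim)
open import Data.Fin using (Fin; toℕ; fromℕ<)
import Data.Fin.Properties as Fin
open import Data.Integer using (ℤ; +_; -_) renaming (_+_ to _+ℤ_; _*_ to _*ℤ_)
import Data.Integer.Properties as ℤ
open import Data.Integer.Tactic.RingSolver using (solve-∀)
open import Data.List using (List; []; _∷_; _++_; map; concatMap; filter; length; deduplicate)
import Data.List.Properties as List
open import Data.List.Membership.Propositional using (_∈_; _∉_; lose; find)
import Data.List.Membership.Propositional.Properties as Mem
open import Data.List.Membership.Propositional.Properties.WithK using (unique∧set⇒bag)
open import Data.List.Relation.Binary.BagAndSetEquality using (∼bag⇒↭)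
import Data.List.Relation.Binary.Permutation.Propositional as Perm
open Perm using (_↭_)
open import Data.List.Relation.Unary.All as All using (All; []; _∷_)
import Data.List.Relation.Unary.All.Properties as AllP
import Data.List.Relation.Unary.AllPairs as AllPairs
open import Data.List.Relation.Unary.AllPairs using ([]; _∷_)
import Data.List.Relation.Unary.AllPairs.Properties as AllPairsP
open import Data.List.Relation.Unary.Any using (here; there)
import Data.List.Relation.Unary.Unique.DecPropositional as DecUnique
import Data.List.Relation.Unary.Unique.DecPropositional.Properties as UniqueDec
open import Data.List.Relation.Unary.Unique.Propositional using (Unique)
import Data.List.Relation.Unary.Unique.Propositional.Properties as UniqueP
open import Data.Nat using (ℕ; zero; suc; _+_; pred; _<_; _≤_; s≤s; z≤n; _<ᵇ_)
open import Data.Nat.Induction using (<-rec)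
import Data.Nat.Properties as ℕ
open import Data.List.Membership.DecPropositional ℕ._≟_ using (_∈?_)
open import Data.Product using (_×_; _,_; proj₁; proj₂; ∃₂)
open import Data.Vec as Vec using (Vec; toList)
import Data.Vec.Properties as VecP
open import Function.Bundles using (mk⇔)
open import Relation.Binary.Definitions using (DecidableEquality)
open import Relation.Binary.PropositionalEquality hiding (subst)
import Relation.Binary.PropositionalEquality as ≡
open import Relation.Nullary using (¬_; Dec; yes; no; does)
open import Relation.Unary using (Decidable)

-- ℤ[ω] with ω² = ω − 1, i.e. ω a primitive sixth root of unity; mk x y stands for x + y ω.
record ℤω : Set where
  constructor mk
  field re im : ℤ

infixl 6 _+ω_
infixl 7 _*ω_

_+ω_ : ℤω → ℤω → ℤω
mk a b +ω mk c d = mk (a +ℤ c) (b +ℤ d)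

_*ω_ : ℤω → ℤω → ℤω
mk a b *ω mk c d = mk (a *ℤ c +ℤ - (b *ℤ d)) (a *ℤ d +ℤ b *ℤ c +ℤ b *ℤ d)

-ω_ : ℤω → ℤω
-ω mk a b = mk (- a) (- b)

0ω 1ω ω ω̄ : ℤω
0ω = mk (+ 0) (+ 0)
1ω = mk (+ 1) (+ 0)
ω = mk (+ 0) (+ 1)
ω̄ = mk (+ 1) (- (+ 1))

emb : ℤ → ℤω
emb k = mk k (+ 0)

ℤω-commutativeRing : CommutativeRing _ _
ℤω-commutativeRing = record
  { Carrier = ℤω ; _≈_ = _≡_ ; _+_ = _+ω_ ; _*_ = _*ω_ ; -_ = -ω_ ; 0# = 0ω ; 1# = 1ω
  ; isCommutativeRing = record
    { isRing = record
      { +-isAbelianGroup = record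
        { isGroup = record
          { isMonoid = record
            { isSemigroup = record
              { isMagma = record { isEquivalence = isEquivalence ; ∙-cong = cong₂ _+ω_ }
              ; assoc = λ { (mk a b) (mk c d) (mk e f) → cong₂ mk (ℤ.+-assoc a c e) (ℤ.+-assoc b d f) } }
            ; identity = (λ { (mk a b) → cong₂ mk (ℤ.+-identityˡ a) (ℤ.+-identityˡ b) })
                       , (λ { (mk a b) → cong₂ mk (ℤ.+-identityʳ a) (ℤ.+-identityʳ b) }) }
          ; inverse = (λ { (mk a b) → cong₂ mk (ℤ.+-inverseˡ a) (ℤ.+-inverseˡ b) })
                    , (λ { (mk a b) → cong₂ mk (ℤ.+-inverseʳ a) (ℤ.+-inverseʳ b) })
          ; ⁻¹-cong = cong -ω_ }
        ; comm = λ { (mk a b) (mk c d) → cong₂ mk (ℤ.+-comm a c) (ℤ.+-comm b d) } }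
      ; *-cong = cong₂ _*ω_
      ; *-assoc = λ { (mk a b) (mk c d) (mk e f) → cong₂ mk (assoc-re a b c d e f) (assoc-im a b c d e f) }
      ; *-identity = (λ { (mk a b) → cong₂ mk (idˡ-re a b) (idˡ-im a b) })
                   , (λ { (mk a b) → cong₂ mk (idʳ-re a b) (idʳ-im a b) })
      ; distrib = (λ { (mk a b) (mk c d) (mk e f) → cong₂ mk (distˡ-re a b c d e f) (distˡ-im a b c d e f) })
                , (λ { (mk a b) (mk c d) (mk e f) → cong₂ mk (distʳ-re a b c d e f) (distʳ-im a b c d e f) }) }
    ; *-comm = λ { (mk a b) (mk c d) → cong₂ mk (comm-re a b c d) (comm-im a b c d) } } }
  where
  assoc-re : ∀ a b c d e f → (a *ℤ c +ℤ - (b *ℤ d)) *ℤ e +ℤ - ((a *ℤ d +ℤ b *ℤ c +ℤ b *ℤ d) *ℤ f)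
                           ≡ a *ℤ (c *ℤ e +ℤ - (d *ℤ f)) +ℤ - (b *ℤ (c *ℤ f +ℤ d *ℤ e +ℤ d *ℤ f))
  assoc-re = solve-∀
  assoc-im : ∀ a b c d e f → (a *ℤ c +ℤ - (b *ℤ d)) *ℤ f +ℤ (a *ℤ d +ℤ b *ℤ c +ℤ b *ℤ d) *ℤ e +ℤ (a *ℤ d +ℤ b *ℤ c +ℤ b *ℤ d) *ℤ f
                           ≡ a *ℤ (c *ℤ f +ℤ d *ℤ e +ℤ d *ℤ f) +ℤ b *ℤ (c *ℤ e +ℤ - (d *ℤ f)) +ℤ b *ℤ (c *ℤ f +ℤ d *ℤ e +ℤ d *ℤ f)
  assoc-im = solve-∀
  idˡ-re : ∀ a b → + 1 *ℤ a +ℤ - (+ 0 *ℤ b) ≡ a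
  idˡ-re = solve-∀
  idˡ-im : ∀ a b → + 1 *ℤ b +ℤ + 0 *ℤ a +ℤ + 0 *ℤ b ≡ b
  idˡ-im = solve-∀
  idʳ-re : ∀ a b → a *ℤ + 1 +ℤ - (b *ℤ + 0) ≡ a
  idʳ-re = solve-∀
  idʳ-im : ∀ a b → a *ℤ + 0 +ℤ b *ℤ + 1 +ℤ b *ℤ + 0 ≡ b
  idʳ-im = solve-∀
  distˡ-re : ∀ a b c d e f → a *ℤ (c +ℤ e) +ℤ - (b *ℤ (d +ℤ f)) ≡ (a *ℤ c +ℤ - (b *ℤ d)) +ℤ (a *ℤ e +ℤ - (b *ℤ f))
  distˡ-re = solve-∀
  distˡ-im : ∀ a b c d e f → a *ℤ (d +ℤ f) +ℤ b *ℤ (c +ℤ e) +ℤ b *ℤ (d +ℤ f)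
                           ≡ (a *ℤ d +ℤ b *ℤ c +ℤ b *ℤ d) +ℤ (a *ℤ f +ℤ b *ℤ e +ℤ b *ℤ f)
  distˡ-im = solve-∀
  distʳ-re : ∀ a b c d e f → (c +ℤ e) *ℤ a +ℤ - ((d +ℤ f) *ℤ b) ≡ (c *ℤ a +ℤ - (d *ℤ b)) +ℤ (e *ℤ a +ℤ - (f *ℤ b))
  distʳ-re = solve-∀
  distʳ-im : ∀ a b c d e f → (c +ℤ e) *ℤ b +ℤ (d +ℤ f) *ℤ a +ℤ (d +ℤ f) *ℤ b
                           ≡ (c *ℤ b +ℤ d *ℤ a +ℤ d *ℤ b) +ℤ (e *ℤ b +ℤ f *ℤ a +ℤ f *ℤ b)
  distʳ-im = solve-∀
  comm-re : ∀ a b c d → a *ℤ c +ℤ - (b *ℤ d) ≡ c *ℤ a +ℤ - (d *ℤ b)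
  comm-re = solve-∀
  comm-im : ∀ a b c d → a *ℤ d +ℤ b *ℤ c +ℤ b *ℤ d ≡ c *ℤ b +ℤ d *ℤ a +ℤ d *ℤ b
  comm-im = solve-∀

open CommutativeRing ℤω-commutativeRing
  using (+-comm; +-assoc; +-identityˡ; +-identityʳ; *-comm; *-assoc; *-identityˡ; *-identityʳ;
         distribˡ; distribʳ; zeroˡ; zeroʳ; -‿inverseʳ; +-commutativeSemigroup; *-commutativeSemigroup; +-commutativeMonoid; +-abelianGroup)
open CommSemigroupProps +-commutativeSemigroup using () renaming (interchange to +-interchange)
open CommSemigroupProps *-commutativeSemigroup using () renaming (interchange to *-interchange)

emb-* : ∀ k l → emb (k *ℤ l) ≡ emb k *ω emb l
emb-* k l = cong₂ mk (re k l) (im k l)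
  where
  re : ∀ k l → k *ℤ l ≡ k *ℤ l +ℤ - (+ 0 *ℤ + 0)
  re = solve-∀
  im : ∀ k l → + 0 ≡ k *ℤ + 0 +ℤ + 0 *ℤ l +ℤ + 0 *ℤ + 0
  im = solve-∀

private variable A B : Set

∑ : List A → (A → ℤω) → ℤω
∑ [] f = 0ω
∑ (x ∷ xs) f = f x +ω ∑ xs f

syntax ∑ xs (λ x → e) = ∑[ x ∈ xs ] e

∑-cong : (xs : List A) {f g : A → ℤω} → (∀ x → f x ≡ g x) → ∑ xs f ≡ ∑ xs g
∑-cong [] e = refl
∑-cong (x ∷ xs) e = cong₂ _+ω_ (e x) (∑-cong xs e)

∑-cong∈ : (xs : List A) {f g : A → ℤω} → (∀ x → x ∈ xs → f x ≡ g x) → ∑ xs f ≡ ∑ xs g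
∑-cong∈ [] e = refl
∑-cong∈ (x ∷ xs) e = cong₂ _+ω_ (e x (here refl)) (∑-cong∈ xs (λ y p → e y (there p)))

∑-++ : (xs ys : List A) (f : A → ℤω) → ∑ (xs ++ ys) f ≡ ∑ xs f +ω ∑ ys f
∑-++ [] ys f = sym (+-identityˡ (∑ ys f))
∑-++ (x ∷ xs) ys f = trans (cong (f x +ω_) (∑-++ xs ys f)) (sym (+-assoc (f x) (∑ xs f) (∑ ys f)))

∑-map : (g : A → B) (xs : List A) (f : B → ℤω) → ∑ (map g xs) f ≡ ∑[ x ∈ xs ] f (g x)
∑-map g [] f = refl
∑-map g (x ∷ xs) f = cong (f (g x) +ω_) (∑-map g xs f)

∑-concatMap : (g : A → List B) (xs : List A) (f : B → ℤω) →
              ∑ (concatMap g xs) f ≡ ∑[ x ∈ xs ] ∑ (g x) f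
∑-concatMap g [] f = refl
∑-concatMap g (x ∷ xs) f = trans (∑-++ (g x) (concatMap g xs) f) (cong (∑ (g x) f +ω_) (∑-concatMap g xs f))

∑-0 : (xs : List A) → ∑[ x ∈ xs ] 0ω ≡ 0ω
∑-0 [] = refl
∑-0 (x ∷ xs) = trans (+-identityˡ (∑[ x ∈ xs ] 0ω)) (∑-0 xs)

∑-+ : (xs : List A) (f g : A → ℤω) → ∑[ x ∈ xs ] (f x +ω g x) ≡ ∑ xs f +ω ∑ xs g
∑-+ [] f g = sym (+-identityˡ 0ω)
∑-+ (x ∷ xs) f g = trans (cong (f x +ω g x +ω_) (∑-+ xs f g)) (+-interchange (f x) (g x) (∑ xs f) (∑ xs g))

∑-*ˡ : (xs : List A) (c : ℤω) (f : A → ℤω) → ∑[ x ∈ xs ] (c *ω f x) ≡ c *ω ∑ xs f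
∑-*ˡ [] c f = sym (zeroʳ c)
∑-*ˡ (x ∷ xs) c f = trans (cong (c *ω f x +ω_) (∑-*ˡ xs c f)) (sym (distribˡ c (f x) (∑ xs f)))

∑-*ʳ : (xs : List A) (c : ℤω) (f : A → ℤω) → ∑[ x ∈ xs ] (f x *ω c) ≡ ∑ xs f *ω c
∑-*ʳ [] c f = sym (zeroˡ c)
∑-*ʳ (x ∷ xs) c f = trans (cong (f x *ω c +ω_) (∑-*ʳ xs c f)) (sym (distribʳ c (f x) (∑ xs f)))

∑-swap : (xs : List A) (ys : List B) (f : A → B → ℤω) →
         ∑[ x ∈ xs ] ∑ ys (f x) ≡ ∑[ y ∈ ys ] ∑[ x ∈ xs ] f x y
∑-swap [] ys f = sym (∑-0 ys)
∑-swap (x ∷ xs) ys f = trans (cong (∑ ys (f x) +ω_) (∑-swap xs ys f)) (sym (∑-+ ys (f x) (λ y → ∑[ x′ ∈ xs ] f x′ y)))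

∑-↭ : {xs ys : List A} (f : A → ℤω) → xs ↭ ys → ∑ xs f ≡ ∑ ys f
∑-↭ f Perm.refl = refl
∑-↭ f (Perm.prep x p) = cong (f x +ω_) (∑-↭ f p)
∑-↭ f (Perm.swap {xs} {ys} x y p) = trans (sym (+-assoc (f x) (f y) (∑ xs f)))
  (trans (cong₂ _+ω_ (+-comm (f x) (f y)) (∑-↭ f p)) (+-assoc (f y) (f x) (∑ ys f)))
∑-↭ f (Perm.trans p q) = trans (∑-↭ f p) (∑-↭ f q)

wordValue : (A → ℤω) → List A → ℤω
wordValue f [] = 1ω
wordValue f (x ∷ w) = f x *ω wordValue f w

termValue : (A → ℤω) → ℤ × List A → ℤω
termValue f (k , w) = emb k *ω wordValue f w

eval : (A → ℤω) → Poly A → ℤω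
eval f p = ∑ p (termValue f)

wordValue-++ : (f : A → ℤω) (v w : List A) → wordValue f (v ++ w) ≡ wordValue f v *ω wordValue f w
wordValue-++ f [] w = sym (*-identityˡ (wordValue f w))
wordValue-++ f (x ∷ v) w = trans (cong (f x *ω_) (wordValue-++ f v w)) (sym (*-assoc (f x) (wordValue f v) (wordValue f w)))

wordValue-cong : {f g : A → ℤω} → (∀ x → f x ≡ g x) → ∀ w → wordValue f w ≡ wordValue g w
wordValue-cong e [] = refl
wordValue-cong e (x ∷ w) = cong₂ _*ω_ (e x) (wordValue-cong e w)

eval-cong : {f g : A → ℤω} → (∀ x → f x ≡ g x) → ∀ p → eval f p ≡ eval g p
eval-cong e p = ∑-cong p (λ { (k , w) → cong (emb k *ω_) (wordValue-cong e w) })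

-- Evaluation is multiplicative: letters commute in ℤω.
eval-· : (f : A → ℤω) (p q : Poly A) → eval f (p · q) ≡ eval f p *ω eval f q
eval-· f p q = begin
  eval f (p · q)
    ≡⟨ ∑-concatMap _ p (termValue f) ⟩
  ∑[ (k , v) ∈ p ] ∑ (map (λ { (l , w) → (k *ℤ l , v ++ w) }) q) (termValue f)
    ≡⟨ ∑-cong p (λ { (k , v) → trans (∑-map _ q (termValue f)) (∑-cong q (λ { (l , w) → termValue-· k v l w })) }) ⟩
  ∑[ s ∈ p ] ∑[ t ∈ q ] (termValue f s *ω termValue f t)
    ≡⟨ ∑-cong p (λ s → ∑-*ˡ q (termValue f s) (termValue f)) ⟩
  ∑[ s ∈ p ] (termValue f s *ω eval f q)
    ≡⟨ ∑-*ʳ p (eval f q) (termValue f) ⟩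
  eval f p *ω eval f q ∎
  where
  open ≡-Reasoning
  termValue-· : ∀ k v l w → termValue f (k *ℤ l , v ++ w) ≡ termValue f (k , v) *ω termValue f (l , w)
  termValue-· k v l w = trans (cong₂ _*ω_ (emb-* k l) (wordValue-++ f v w)) (*-interchange (emb k) (emb l) (wordValue f v) (wordValue f w))

eval-substWord : (σ : A → Poly B) (g : B → ℤω) (w : List A) →
                 eval g (substWord σ w) ≡ wordValue (λ x → eval g (σ x)) w
eval-substWord σ g [] = refl
eval-substWord σ g (x ∷ w) =
  trans (eval-· g (σ x) (substWord σ w)) (cong (eval g (σ x) *ω_) (eval-substWord σ g w))

eval-subst : (σ : A → Poly B) (g : B → ℤω) (p : Poly A) → eval g (subst σ p) ≡ eval (λ x → eval g (σ x)) p
eval-subst σ g p = trans (∑-concatMap _ p (termValue g)) (∑-cong p (λ { (k , w) → scaledTerm k w }))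
  where
  open ≡-Reasoning
  scaledTerm : ∀ k w → ∑ (map (λ { (l , v) → (k *ℤ l , v) }) (substWord σ w)) (termValue g)
                     ≡ emb k *ω wordValue (λ x → eval g (σ x)) w
  scaledTerm k w = begin
    ∑ (map _ (substWord σ w)) (termValue g)
      ≡⟨ ∑-map _ (substWord σ w) (termValue g) ⟩
    ∑[ (l , v) ∈ substWord σ w ] (emb (k *ℤ l) *ω wordValue g v)
      ≡⟨ ∑-cong (substWord σ w) (λ { (l , v) → trans (cong (_*ω wordValue g v) (emb-* k l)) (*-assoc (emb k) (emb l) (wordValue g v)) }) ⟩
    ∑[ t ∈ substWord σ w ] (emb k *ω termValue g t)
      ≡⟨ ∑-*ˡ (substWord σ w) (emb k) (termValue g) ⟩
    emb k *ω eval g (substWord σ w)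
      ≡⟨ cong (emb k *ω_) (eval-substWord σ g w) ⟩
    emb k *ω wordValue (λ x → eval g (σ x)) w ∎

coeffSum-eval : (p : Poly A) → emb (coeffSum p) ≡ eval (λ _ → 1ω) p
coeffSum-eval [] = refl
coeffSum-eval ((k , w) ∷ p) = cong₂ _+ω_ (sym (trans (cong (emb k *ω_) (wordValue-1 w)) (*-identityʳ (emb k))))
                                         (coeffSum-eval p)
  where
  wordValue-1 : ∀ w → wordValue (λ _ → 1ω) w ≡ 1ω
  wordValue-1 [] = refl
  wordValue-1 (x ∷ w) = trans (*-identityˡ (wordValue (λ _ → 1ω) w)) (wordValue-1 w)

𝟙 : {P : Set} → Dec P → ℤω
𝟙 d = if does d then 1ω else 0ω

length-filter : {P : A → Set} (P? : Decidable P) (xs : List A) → emb (+ length (filter P? xs)) ≡ ∑[ x ∈ xs ] 𝟙 (P? x)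
length-filter P? [] = refl
length-filter P? (x ∷ xs) with does (P? x)
... | true = cong (1ω +ω_) (length-filter P? xs)
... | false = trans (length-filter P? xs) (sym (+-identityˡ (∑[ x ∈ xs ] 𝟙 (P? x))))

module Fibres {Key : Set} (_≟_ : DecidableEquality Key) where

  δ-∉ : ∀ u₀ (D : List Key) (F : Key → ℤω) → u₀ ∉ D → ∑[ u ∈ D ] (𝟙 (u₀ ≟ u) *ω F u) ≡ 0ω
  δ-∉ u₀ [] F u₀∉ = refl
  δ-∉ u₀ (u ∷ D) F u₀∉ with u₀ ≟ u
  ... | yes u₀≡u = ⊥-elim (u₀∉ (here u₀≡u))
  ... | no _ = trans (cong (_+ω ∑[ u ∈ D ] (𝟙 (u₀ ≟ u) *ω F u)) (zeroˡ (F u)))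
                     (trans (+-identityˡ (∑[ u ∈ D ] (𝟙 (u₀ ≟ u) *ω F u))) (δ-∉ u₀ D F (λ p → u₀∉ (there p))))

  δ-∈ : ∀ u₀ (D : List Key) (F : Key → ℤω) → Unique D → u₀ ∈ D → ∑[ u ∈ D ] (𝟙 (u₀ ≟ u) *ω F u) ≡ F u₀
  δ-∈ u₀ (u ∷ D) F (u∉D ∷ _) (here refl) with u₀ ≟ u₀
  ... | yes _ = trans (cong₂ _+ω_ (*-identityˡ (F u₀)) (δ-∉ u₀ D F (AllP.All¬⇒¬Any u∉D))) (+-identityʳ (F u₀))
  ... | no u₀≢u₀ = ⊥-elim (u₀≢u₀ refl)
  δ-∈ u₀ (u ∷ D) F (u∉D ∷ _) (there p) with u₀ ≟ u
  ... | yes refl = ⊥-elim (AllP.All¬⇒¬Any u∉D p)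
  δ-∈ u₀ (u ∷ D) F (_ ∷ uniq) (there p) | no _ =
    trans (cong (_+ω ∑[ u ∈ D ] (𝟙 (u₀ ≟ u) *ω F u)) (zeroˡ (F u)))
          (trans (+-identityˡ (∑[ u ∈ D ] (𝟙 (u₀ ≟ u) *ω F u))) (δ-∈ u₀ D F uniq p))

  ∑-fibres : {X : Set} (xs : List X) (key : X → Key) (wt : X → ℤω) (g : Key → ℤω) (D : List Key) →
             Unique D → (∀ x → x ∈ xs → key x ∈ D) →
             ∑[ x ∈ xs ] (wt x *ω g (key x)) ≡ ∑[ u ∈ D ] (∑[ x ∈ xs ] (𝟙 (key x ≟ u) *ω wt x) *ω g u)
  ∑-fibres xs key wt g D uniq keys∈D = begin
    ∑[ x ∈ xs ] (wt x *ω g (key x))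
      ≡⟨ ∑-cong∈ xs (λ x x∈xs → sym (δ-∈ (key x) D (λ u → wt x *ω g u) uniq (keys∈D x x∈xs))) ⟩
    ∑[ x ∈ xs ] ∑[ u ∈ D ] (𝟙 (key x ≟ u) *ω (wt x *ω g u))
      ≡⟨ ∑-cong xs (λ x → ∑-cong D (λ u → sym (*-assoc (𝟙 (key x ≟ u)) (wt x) (g u)))) ⟩
    ∑[ x ∈ xs ] ∑[ u ∈ D ] ((𝟙 (key x ≟ u) *ω wt x) *ω g u)
      ≡⟨ ∑-swap xs D (λ x u → (𝟙 (key x ≟ u) *ω wt x) *ω g u) ⟩
    ∑[ u ∈ D ] ∑[ x ∈ xs ] ((𝟙 (key x ≟ u) *ω wt x) *ω g u)
      ≡⟨ ∑-cong D (λ u → ∑-*ʳ xs (g u) (λ x → 𝟙 (key x ≟ u) *ω wt x)) ⟩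
    ∑[ u ∈ D ] (∑[ x ∈ xs ] (𝟙 (key x ≟ u) *ω wt x) *ω g u) ∎
    where open ≡-Reasoning

coeff-∑ : (eq : DecidableEquality (List A)) (p : Poly A) (u : List A) →
          emb (coeff eq p u) ≡ ∑[ t ∈ p ] (𝟙 (eq (proj₂ t) u) *ω emb (proj₁ t))
coeff-∑ eq [] u = refl
coeff-∑ eq ((k , w) ∷ p) u with eq w u
... | yes _ = cong₂ _+ω_ (sym (*-identityˡ (emb k))) (coeff-∑ eq p u)
... | no _ = trans (coeff-∑ eq p u) (sym (trans (cong (_+ω rest) (zeroˡ (emb k))) (+-identityˡ rest)))
  where rest = ∑[ t ∈ p ] (𝟙 (eq (proj₂ t) u) *ω emb (proj₁ t))

-- The letter values a ↦ ω and b ↦ ω̄ = 1 − ω, under which c = a + b ↦ 1 and d = ab + ba ↦ 2.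
abValue : AB → ℤω
abValue 𝐚 = ω
abValue 𝐛 = ω̄

descentWord : {n : ℕ} → Vec (Fin n) n → List AB
descentWord σ = descWord (permList σ)

-- If Φ is a cd-index of Bₙ, then Φ(a + b, ab + ba) at (ω, ω̄) is ∑_σ ω^asc(σ) ω̄^des(σ):
-- both sides regroup, word by word, into ∑_u βₙ(u) u(ω, ω̄).
Ψ-value : (n : ℕ) (Φ : Poly CD) → IsCdIndex n Φ →
          eval abValue (subst abSub Φ) ≡ ∑[ σ ∈ perms n ] wordValue abValue (descentWord σ)
Ψ-value n Φ isCd = begin
  eval abValue Ψ
    ≡⟨ ∑-fibres Ψ proj₂ (λ t → emb (proj₁ t)) value D uniqueD (λ t t∈Ψ → inD (Mem.∈-++⁺ˡ (Mem.∈-map⁺ proj₂ t∈Ψ))) ⟩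
  ∑[ u ∈ D ] (∑[ t ∈ Ψ ] (𝟙 (proj₂ t ≟ABw u) *ω emb (proj₁ t)) *ω value u)
    ≡⟨ ∑-cong D (λ u → cong (_*ω value u) (trans (sym (coeff-∑ _≟ABw_ Ψ u)) (cong emb (isCd u)))) ⟩
  ∑[ u ∈ D ] (emb (+ βword n u) *ω value u)
    ≡⟨ ∑-cong D (λ u → cong (_*ω value u) (trans (length-filter (λ σ → descentWord σ ≟ABw u) (perms n))
                                                 (∑-cong (perms n) (λ σ → sym (*-identityʳ (𝟙 (descentWord σ ≟ABw u))))))) ⟩
  ∑[ u ∈ D ] (∑[ σ ∈ perms n ] (𝟙 (descentWord σ ≟ABw u) *ω 1ω) *ω value u)
    ≡⟨ ∑-fibres (perms n) descentWord (λ _ → 1ω) value D uniqueD (λ σ σ∈ → inD (Mem.∈-++⁺ʳ _ (Mem.∈-map⁺ descentWord σ∈))) ⟨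
  ∑[ σ ∈ perms n ] (1ω *ω value (descentWord σ))
    ≡⟨ ∑-cong (perms n) (λ σ → *-identityˡ (value (descentWord σ))) ⟩
  ∑[ σ ∈ perms n ] value (descentWord σ) ∎
  where
  open ≡-Reasoning
  open Fibres _≟ABw_
  Ψ = subst abSub Φ
  value = wordValue abValue
  D = deduplicate _≟ABw_ (map proj₂ Ψ ++ map descentWord (perms n))
  uniqueD : Unique D
  uniqueD = UniqueDec.deduplicate-! _≟ABw_ _
  inD : ∀ {u} → u ∈ map proj₂ Ψ ++ map descentWord (perms n) → u ∈ D
  inD = Mem.∈-deduplicate⁺ _≟ABw_

insertions : ℕ → List ℕ → List (List ℕ)
insertions x [] = (x ∷ []) ∷ []
insertions x (y ∷ l) = (x ∷ y ∷ l) ∷ map (y ∷_) (insertions x l)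

minInsertions : List ℕ → List (List ℕ)
minInsertions τ = insertions 0 (map suc τ)

permsByInsertion : ℕ → List (List ℕ)
permsByInsertion zero = [] ∷ []
permsByInsertion (suc n) = concatMap minInsertions (permsByInsertion n)

IsPerm : ℕ → List ℕ → Set
IsPerm n l = length l ≡ n × All (_< n) l × Unique l

insertions-length : ∀ x l {v} → v ∈ insertions x l → length v ≡ suc (length l)
insertions-length x [] (here refl) = refl
insertions-length x (y ∷ l) (here refl) = refl
insertions-length x (y ∷ l) (there p) with Mem.∈-map⁻ (y ∷_) p
... | v , p′ , refl = cong suc (insertions-length x l p′)

insertions-All : ∀ {Q : ℕ → Set} x l {v} → Q x → All Q l → v ∈ insertions x l → All Q v
insertions-All x [] qx ql (here refl) = qx ∷ []
insertions-All x (y ∷ l) qx ql (here refl) = qx ∷ ql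
insertions-All x (y ∷ l) qx (qy ∷ ql) (there p) with Mem.∈-map⁻ (y ∷_) p
... | v , p′ , refl = qy ∷ insertions-All x l qx ql p′

insertions-Unique : ∀ x l {v} → x ∉ l → Unique l → v ∈ insertions x l → Unique v
insertions-Unique x [] x∉ u (here refl) = [] ∷ []
insertions-Unique x (y ∷ l) x∉ u (here refl) = AllP.¬Any⇒All¬ (y ∷ l) x∉ ∷ u
insertions-Unique x (y ∷ l) x∉ (y∉l ∷ u) (there p) with Mem.∈-map⁻ (y ∷_) p
... | v , p′ , refl = insertions-All {Q = λ e → ¬ y ≡ e} x l (λ e → x∉ (here (sym e))) y∉l p′
                    ∷ insertions-Unique x l (λ q → x∉ (there q)) u p′

insertions-complete : ∀ x A B → A ++ x ∷ B ∈ insertions x (A ++ B)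
insertions-complete x [] [] = here refl
insertions-complete x [] (y ∷ B) = here refl
insertions-complete x (a ∷ A) B = there (Mem.∈-map⁺ (a ∷_) (insertions-complete x A B))

insertions-distinct : ∀ x l → x ∉ l → Unique (insertions x l)
insertions-distinct x [] x∉ = [] ∷ []
insertions-distinct x (y ∷ l) x∉ =
  AllP.map⁺ (All.tabulate (λ _ e → x∉ (here (List.∷-injectiveˡ e))))
  ∷ UniqueP.map⁺ List.∷-injectiveʳ (insertions-distinct x l (λ q → x∉ (there q)))

-- Deleting the inserted 0 recovers the shifted permutation; hence minInsertions is injective.
deleteZeros : List ℕ → List ℕ
deleteZeros [] = []
deleteZeros (zero ∷ l) = deleteZeros l
deleteZeros (suc y ∷ l) = suc y ∷ deleteZeros l

deleteZeros-minInsertions : ∀ τ {v} → v ∈ minInsertions τ → deleteZeros v ≡ map suc τ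
deleteZeros-minInsertions [] (here refl) = refl
deleteZeros-minInsertions (y ∷ τ) (here refl) = cong (suc y ∷_) (unshifted τ)
  where
  unshifted : ∀ τ → deleteZeros (map suc τ) ≡ map suc τ
  unshifted [] = refl
  unshifted (y ∷ τ) = cong (suc y ∷_) (unshifted τ)
deleteZeros-minInsertions (y ∷ τ) (there p) with Mem.∈-map⁻ (suc y ∷_) p
... | v , p′ , refl = cong (suc y ∷_) (deleteZeros-minInsertions τ p′)

0∉shifted : ∀ τ → 0 ∉ map suc τ
0∉shifted τ p with Mem.∈-map⁻ suc p
... | _ , _ , ()

permsByInsertion-Unique : ∀ n → Unique (permsByInsertion n)
permsByInsertion-Unique zero = [] ∷ []
permsByInsertion-Unique (suc n) = UniqueP.concat⁺
  (AllP.map⁺ (All.tabulate (λ {τ} _ → insertions-distinct 0 (map suc τ) (0∉shifted τ))))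
  (AllPairsP.map⁺ (AllPairs.map disjoint (permsByInsertion-Unique n)))
  where
  disjoint : ∀ {τ τ′} → ¬ τ ≡ τ′ → ∀ {v} → v ∈ minInsertions τ × v ∈ minInsertions τ′ → ⊥
  disjoint τ≢τ′ (v∈ , v∈′) = τ≢τ′ (List.map-injective ℕ.suc-injective
    (trans (sym (deleteZeros-minInsertions _ v∈)) (deleteZeros-minInsertions _ v∈′)))

permsByInsertion-sound : ∀ n {l} → l ∈ permsByInsertion n → IsPerm n l
permsByInsertion-sound zero (here refl) = refl , [] , []
permsByInsertion-sound (suc n) {l} p with find (Mem.∈-concatMap⁻ minInsertions {xs = permsByInsertion n} p)
... | τ , τ∈ , l∈ with permsByInsertion-sound n τ∈
... | lengthτ , boundedτ , uniqueτ =
  trans (insertions-length 0 (map suc τ) l∈) (cong suc (trans (List.length-map suc τ) lengthτ)) ,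
  insertions-All 0 (map suc τ) (s≤s z≤n) (AllP.map⁺ (All.map s≤s boundedτ)) l∈ ,
  insertions-Unique 0 (map suc τ) (0∉shifted τ) (UniqueP.map⁺ ℕ.suc-injective uniqueτ) l∈

Unique-delete : ∀ (A : List ℕ) {x B} → Unique (A ++ x ∷ B) → Unique (A ++ B) × x ∉ A ++ B
Unique-delete [] (x∉B ∷ uB) = uB , AllP.All¬⇒¬Any x∉B
Unique-delete (a ∷ A) {x} {B} (a∉ ∷ u) with Unique-delete A u | AllP.++⁻ A a∉
... | u′ , x∉ | a∉A , (a≢x ∷ a∉B) = AllP.++⁺ a∉A a∉B ∷ u′ , λ { (here x≡a) → a≢x (sym x≡a) ; (there q) → x∉ q }

length-delete : ∀ A (x : ℕ) B → length (A ++ x ∷ B) ≡ suc (length (A ++ B))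
length-delete [] x B = refl
length-delete (a ∷ A) x B = cong suc (length-delete A x B)

All-delete : ∀ {Q : ℕ → Set} A {x B} → All Q (A ++ x ∷ B) → All Q (A ++ B)
All-delete A qs with AllP.++⁻ A qs
... | qA , (_ ∷ qB) = AllP.++⁺ qA qB

bounded-avoiding : ∀ {n} xs → All (_< suc n) xs → All (λ e → ¬ n ≡ e) xs → All (_< n) xs
bounded-avoiding [] [] [] = []
bounded-avoiding (x ∷ xs) (s≤s x≤n ∷ ps) (n≢x ∷ qs) = ℕ.≤∧≢⇒< x≤n (λ e → n≢x (sym e)) ∷ bounded-avoiding xs ps qs

Unique-bounded-length : ∀ n l → Unique l → All (_< n) l → length l ≤ n
Unique-bounded-length zero [] _ _ = z≤n
Unique-bounded-length zero (x ∷ l) _ (() ∷ _)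
Unique-bounded-length (suc n) l u bounded with n ∈? l
... | no n∉ = ℕ.m≤n⇒m≤1+n (Unique-bounded-length n l u (bounded-avoiding l bounded (AllP.¬Any⇒All¬ l n∉)))
... | yes n∈ = delete-n (Mem.∈-∃++ n∈)
  where
  delete-n : (∃₂ λ A B → l ≡ A ++ n ∷ B) → length l ≤ suc n
  delete-n (A , B , refl) with Unique-delete A u
  ... | u′ , n∉ = ≡.subst (_≤ suc n) (sym (length-delete A n B))
      (s≤s (Unique-bounded-length n (A ++ B) u′ (bounded-avoiding (A ++ B) (All-delete A bounded) (AllP.¬Any⇒All¬ (A ++ B) n∉))))

unshift : ∀ l → All (λ e → ¬ 0 ≡ e) l → l ≡ map suc (map pred l)
unshift [] [] = refl
unshift (zero ∷ l) (0≢0 ∷ _) = ⊥-elim (0≢0 refl)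
unshift (suc x ∷ l) (_ ∷ qs) = cong (suc x ∷_) (unshift l qs)

unshift-bounded : ∀ {n} l → All (_< suc n) l → All (λ e → ¬ 0 ≡ e) l → All (_< n) (map pred l)
unshift-bounded [] [] [] = []
unshift-bounded (zero ∷ l) _ (0≢0 ∷ _) = ⊥-elim (0≢0 refl)
unshift-bounded (suc x ∷ l) (s≤s x<n ∷ ps) (_ ∷ qs) = x<n ∷ unshift-bounded l ps qs

-- A permutation of {0,…,n} contains 0, by pigeonhole.
IsPerm-0∈ : ∀ n l → IsPerm (suc n) l → 0 ∈ l
IsPerm-0∈ n l (len , bounded , u) with 0 ∈? l
... | yes 0∈l = 0∈l
... | no 0∉l = ⊥-elim (ℕ.<-irrefl refl (≡.subst (_≤ n) (trans (List.length-map pred l) len)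
    (Unique-bounded-length n (map pred l) (UniqueP.map⁻ (≡.subst Unique (unshift l no0) u)) (unshift-bounded l bounded no0))))
  where no0 = AllP.¬Any⇒All¬ l 0∉l

permsByInsertion-complete : ∀ n {l} → IsPerm n l → l ∈ permsByInsertion n
permsByInsertion-complete zero {[]} _ = here refl
permsByInsertion-complete zero {x ∷ l} (() , _)
permsByInsertion-complete (suc n) {l} isPerm@(len , bounded , u) = delete-0 (Mem.∈-∃++ (IsPerm-0∈ n l isPerm))
  where
  delete-0 : (∃₂ λ A B → l ≡ A ++ 0 ∷ B) → l ∈ permsByInsertion (suc n)
  delete-0 (A , B , refl) = Mem.∈-concatMap⁺ minInsertions (lose τ∈ (≡.subst (λ X → A ++ 0 ∷ B ∈ insertions 0 X) shifted (insertions-complete 0 A B)))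
    where
    no0 = AllP.¬Any⇒All¬ (A ++ B) (proj₂ (Unique-delete A u))
    τ = map pred (A ++ B)
    shifted : A ++ B ≡ map suc τ
    shifted = unshift (A ++ B) no0
    τ∈ : τ ∈ permsByInsertion n
    τ∈ = permsByInsertion-complete n
      ( trans (List.length-map pred (A ++ B)) (ℕ.suc-injective (trans (sym (length-delete A 0 B)) len))
      , unshift-bounded (A ++ B) (All-delete A bounded) no0
      , UniqueP.map⁻ (≡.subst Unique shifted (proj₁ (Unique-delete A u))))

allVecs-Unique : ∀ n k → Unique (allVecs n k)
allVecs-Unique n zero = [] ∷ []
allVecs-Unique n (suc k) = UniqueP.concat⁺
  (AllP.map⁺ (All.tabulate (λ _ → UniqueP.map⁺ (λ e → proj₂ (VecP.∷-injective e)) (allVecs-Unique n k))))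
  (AllPairsP.map⁺ (AllPairs.map disjoint (UniqueP.allFin⁺ n)))
  where
  disjoint : ∀ {i j : Fin n} → ¬ i ≡ j → ∀ {v} → v ∈ map (i Vec.∷_) (allVecs n k) × v ∈ map (j Vec.∷_) (allVecs n k) → ⊥
  disjoint i≢j (p , q) with Mem.∈-map⁻ _ p | Mem.∈-map⁻ _ q
  ... | _ , _ , refl | _ , _ , refl = i≢j refl

allVecs-complete : ∀ n k (v : Vec (Fin n) k) → v ∈ allVecs n k
allVecs-complete n zero Vec.[] = here refl
allVecs-complete n (suc k) (i Vec.∷ v) =
  Mem.∈-concatMap⁺ (λ i → map (i Vec.∷_) (allVecs n k)) (lose (Mem.∈-allFin i) (Mem.∈-map⁺ (i Vec.∷_) (allVecs-complete n k v)))

permList-injective : ∀ {n} {σ τ : Vec (Fin n) n} → permList σ ≡ permList τ → σ ≡ τ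
permList-injective {σ = σ} e =
  trans (sym (VecP.cast-is-id refl σ)) (VecP.toList-injective refl _ _ (List.map-injective Fin.toℕ-injective e))

perms-Unique : ∀ n → Unique (map permList (perms n))
perms-Unique n = UniqueP.map⁺ permList-injective (UniqueP.filter⁺ (λ σ → DecUnique.unique? Fin._≟_ (toList σ)) (allVecs-Unique n n))

perms-sound : ∀ n {l} → l ∈ map permList (perms n) → IsPerm n l
perms-sound n p with Mem.∈-map⁻ permList p
... | σ , σ∈ , refl with Mem.∈-filter⁻ (λ σ → DecUnique.unique? Fin._≟_ (toList σ)) {xs = allVecs n n} σ∈
... | _ , uniqueσ =
  trans (List.length-map toℕ (toList σ)) (VecP.length-toList σ) ,
  AllP.map⁺ (All.tabulate (λ {i} _ → Fin.toℕ<n i)) ,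
  UniqueP.map⁺ Fin.toℕ-injective uniqueσ

toFins : ∀ {n} (l : List ℕ) → All (_< n) l → List (Fin n)
toFins [] [] = []
toFins (x ∷ l) (x<n ∷ bounded) = fromℕ< x<n ∷ toFins l bounded

toℕ-toFins : ∀ {n} (l : List ℕ) (bounded : All (_< n) l) → map toℕ (toFins l bounded) ≡ l
toℕ-toFins [] [] = refl
toℕ-toFins (x ∷ l) (x<n ∷ bounded) = cong₂ _∷_ (Fin.toℕ-fromℕ< x<n) (toℕ-toFins l bounded)

perms-complete : ∀ n {l} → IsPerm n l → l ∈ map permList (perms n)
perms-complete n {l} (len , bounded , u) = ≡.subst (_∈ map permList (perms n)) permList-σ (Mem.∈-map⁺ permList σ∈)
  where
  fins = toFins l bounded
  σ : Vec (Fin n) n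
  σ = Vec.cast (trans (sym (List.length-map toℕ fins)) (trans (cong length (toℕ-toFins l bounded)) len)) (Vec.fromList fins)
  toList-σ : toList σ ≡ fins
  toList-σ = trans (VecP.toList-cast _ (Vec.fromList fins)) (VecP.toList∘fromList fins)
  permList-σ : permList σ ≡ l
  permList-σ = trans (cong (map toℕ) toList-σ) (toℕ-toFins l bounded)
  σ∈ : σ ∈ perms n
  σ∈ = Mem.∈-filter⁺ (λ σ → DecUnique.unique? Fin._≟_ (toList σ)) (allVecs-complete n n σ)
         (UniqueP.map⁻ (≡.subst Unique (sym permList-σ) u))

-- Both enumerations list the same permutations without repetition, so sums over them agree.
perms-sum : ∀ n (h : List ℕ → ℤω) → ∑[ σ ∈ perms n ] h (permList σ) ≡ ∑ (permsByInsertion n) h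
perms-sum n h = trans (sym (∑-map permList (perms n) h)) (∑-↭ h (∼bag⇒↭ (unique∧set⇒bag (perms-Unique n) (permsByInsertion-Unique n)
  (mk⇔ (λ p → permsByInsertion-complete n (perms-sound n p)) (λ p → perms-complete n (permsByInsertion-sound n p))))))

-- Inserting a new minimum into a nonempty permutation with descent word u:
-- in front it prepends an ascent a; right after the i-th entry it turns the letter uᵢ
-- into ba, and after the last entry it appends b.  afterEntries lists all but the first.
afterEntries : List AB → List (List AB)
afterEntries [] = (𝐛 ∷ []) ∷ []
afterEntries (c ∷ u) = (𝐛 ∷ 𝐚 ∷ u) ∷ map (c ∷_) (afterEntries u)

betweenEntries : List AB → List (List AB)
betweenEntries [] = []
betweenEntries (c ∷ u) = (𝐛 ∷ 𝐚 ∷ u) ∷ map (c ∷_) (betweenEntries u)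

insertMin : List AB → List (List AB)
insertMin u = (𝐚 ∷ u) ∷ afterEntries u

insertMin-descWord : ∀ y τ → map descWord (minInsertions (y ∷ τ)) ≡ insertMin (descWord (y ∷ τ))
insertMin-descWord y τ = cong₂ (λ w ws → (𝐚 ∷ w) ∷ ws) (descWord-shift (y ∷ τ))
  (trans (sym (List.map-∘ (insertions 0 (map suc τ)))) (trans (inner y τ) (cong afterEntries (descWord-shift (y ∷ τ)))))
  where
  descWord-shift : ∀ l → descWord (map suc l) ≡ descWord l
  descWord-shift [] = refl
  descWord-shift (x ∷ []) = refl
  descWord-shift (x ∷ y ∷ l) = cong (_ ∷_) (descWord-shift (y ∷ l))
  inner : ∀ y τ → map (λ v → descWord (suc y ∷ v)) (insertions 0 (map suc τ)) ≡ afterEntries (descWord (suc y ∷ map suc τ))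
  inner y [] = refl
  inner y (z ∷ τ) = cong ((𝐛 ∷ 𝐚 ∷ descWord (suc z ∷ map suc τ)) ∷_) (begin
    map (λ v → descWord (suc y ∷ v)) (map (suc z ∷_) X)        ≡⟨ List.map-∘ X ⟨
    map (λ v → descWord (suc y ∷ suc z ∷ v)) X                 ≡⟨ List.map-∘ X ⟩
    map (c ∷_) (map (λ v → descWord (suc z ∷ v)) X)            ≡⟨ cong (map (c ∷_)) (inner z τ) ⟩
    map (c ∷_) (afterEntries (descWord (suc z ∷ map suc τ)))  ∎)
    where
    open ≡-Reasoning
    X = insertions 0 (map suc τ)
    c = if suc z <ᵇ suc y then 𝐛 else 𝐚

descentSum : ℕ → (List AB → ℤω) → ℤω
descentSum n h = ∑[ l ∈ permsByInsertion n ] h (descWord l)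

insertMinSum : (List AB → ℤω) → List AB → ℤω
insertMinSum h u = ∑ (insertMin u) h

descentSum-step : ∀ n h → descentSum (suc (suc n)) h ≡ descentSum (suc n) (insertMinSum h)
descentSum-step n h =
  trans (∑-concatMap minInsertions (permsByInsertion (suc n)) (λ l → h (descWord l))) (∑-cong∈ (permsByInsertion (suc n)) step)
  where
  step : ∀ τ → τ ∈ permsByInsertion (suc n) → ∑[ l ∈ minInsertions τ ] h (descWord l) ≡ insertMinSum h (descWord τ)
  step τ τ∈ with permsByInsertion-sound (suc n) τ∈
  step [] _ | () , _
  step (y ∷ τ) _ | _ = trans (sym (∑-map descWord (minInsertions (y ∷ τ)) h)) (cong (λ ws → ∑ ws h) (insertMin-descWord y τ))

afterEntries-split : ∀ u → afterEntries u ≡ betweenEntries u ++ (u ++ 𝐛 ∷ []) ∷ []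
afterEntries-split [] = refl
afterEntries-split (c ∷ u) = cong ((𝐛 ∷ 𝐚 ∷ u) ∷_)
  (trans (cong (map (c ∷_)) (afterEntries-split u)) (List.map-++ (c ∷_) (betweenEntries u) ((u ++ 𝐛 ∷ []) ∷ [])))

∑-afterEntries-++ : ∀ x v (h : List AB → ℤω) →
  ∑ (afterEntries (x ++ v)) h ≡ ∑[ w ∈ betweenEntries x ] h (w ++ v) +ω ∑[ w ∈ afterEntries v ] h (x ++ w)
∑-afterEntries-++ [] v h = sym (+-identityˡ (∑ (afterEntries v) h))
∑-afterEntries-++ (c ∷ x) v h = begin
  h (𝐛 ∷ 𝐚 ∷ x ++ v) +ω ∑ (map (c ∷_) (afterEntries (x ++ v))) h
    ≡⟨ cong (h (𝐛 ∷ 𝐚 ∷ x ++ v) +ω_) (trans (∑-map (c ∷_) (afterEntries (x ++ v)) h) (∑-afterEntries-++ x v (λ w → h (c ∷ w)))) ⟩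
  h (𝐛 ∷ 𝐚 ∷ x ++ v) +ω (∑[ w ∈ betweenEntries x ] h (c ∷ w ++ v) +ω ∑[ w ∈ afterEntries v ] h (c ∷ x ++ w))
    ≡⟨ +-assoc (h (𝐛 ∷ 𝐚 ∷ x ++ v)) _ _ ⟨
  (h (𝐛 ∷ 𝐚 ∷ x ++ v) +ω ∑[ w ∈ betweenEntries x ] h (c ∷ w ++ v)) +ω ∑[ w ∈ afterEntries v ] h (c ∷ x ++ w)
    ≡⟨ cong (λ t → (h (𝐛 ∷ 𝐚 ∷ x ++ v) +ω t) +ω ∑[ w ∈ afterEntries v ] h (c ∷ x ++ w)) (∑-map (c ∷_) (betweenEntries x) (λ w → h (w ++ v))) ⟨
  (h (𝐛 ∷ 𝐚 ∷ x ++ v) +ω ∑[ w ∈ map (c ∷_) (betweenEntries x) ] h (w ++ v)) +ω ∑[ w ∈ afterEntries v ] h (c ∷ x ++ w) ∎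
  where open ≡-Reasoning

∑-afterEntries : ∀ u (g : List AB → ℤω) → ∑ (afterEntries u) g ≡ ∑ (betweenEntries u) g +ω (g (u ++ 𝐛 ∷ []) +ω 0ω)
∑-afterEntries u g = trans (cong (λ ws → ∑ ws g) (afterEntries-split u)) (∑-++ (betweenEntries u) ((u ++ 𝐛 ∷ []) ∷ []) g)

-- How one insertion of a new minimum interacts with the three shapes of a descent word
-- around an entry m that is smaller than all its neighbours: a new minimum goes to the
-- left or to the right of m, and m keeps its shape.
module _ (h : List AB → ℤω) where
  open CommMonoidSolver +-commutativeMonoid using (solve; _⊕_; _⊜_; id)
  open ≡-Reasoning

  insertMin-front : ∀ y → insertMinSum h (𝐚 ∷ y) ≡ h (𝐛 ∷ 𝐚 ∷ y) +ω insertMinSum (λ w → h (𝐚 ∷ w)) y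
  insertMin-front y = begin
    h (𝐚 ∷ 𝐚 ∷ y) +ω (h (𝐛 ∷ 𝐚 ∷ y) +ω ∑ (map (𝐚 ∷_) (afterEntries y)) h)
      ≡⟨ cong (λ t → h (𝐚 ∷ 𝐚 ∷ y) +ω (h (𝐛 ∷ 𝐚 ∷ y) +ω t)) (∑-map (𝐚 ∷_) (afterEntries y) h) ⟩
    h (𝐚 ∷ 𝐚 ∷ y) +ω (h (𝐛 ∷ 𝐚 ∷ y) +ω ∑[ w ∈ afterEntries y ] h (𝐚 ∷ w))
      ≡⟨ solve 3 (λ A B C → A ⊕ (B ⊕ C) ⊜ B ⊕ (A ⊕ C)) refl (h (𝐚 ∷ 𝐚 ∷ y)) (h (𝐛 ∷ 𝐚 ∷ y)) (∑[ w ∈ afterEntries y ] h (𝐚 ∷ w)) ⟩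
    h (𝐛 ∷ 𝐚 ∷ y) +ω (h (𝐚 ∷ 𝐚 ∷ y) +ω ∑[ w ∈ afterEntries y ] h (𝐚 ∷ w)) ∎

  insertMin-end : ∀ x → insertMinSum h (x ++ 𝐛 ∷ []) ≡ insertMinSum (λ w → h (w ++ 𝐛 ∷ [])) x +ω h (x ++ 𝐛 ∷ 𝐚 ∷ [])
  insertMin-end x = begin
    front +ω ∑ (afterEntries (x ++ 𝐛 ∷ [])) h
      ≡⟨ cong (front +ω_) (∑-afterEntries-++ x (𝐛 ∷ []) h) ⟩
    front +ω (inside +ω (newBA +ω (newBB +ω 0ω)))
      ≡⟨ solve 4 (λ A B C D → A ⊕ (B ⊕ (C ⊕ (D ⊕ id))) ⊜ (A ⊕ (B ⊕ (D ⊕ id))) ⊕ C) refl front inside newBA newBB ⟩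
    (front +ω (inside +ω (newBB +ω 0ω))) +ω newBA
      ≡⟨ cong (λ t → (front +ω (inside +ω (h t +ω 0ω))) +ω newBA) (List.++-assoc x (𝐛 ∷ []) (𝐛 ∷ [])) ⟨
    (front +ω (inside +ω (h ((x ++ 𝐛 ∷ []) ++ 𝐛 ∷ []) +ω 0ω))) +ω newBA
      ≡⟨ cong (λ t → (front +ω t) +ω newBA) (∑-afterEntries x (λ w → h (w ++ 𝐛 ∷ []))) ⟨
    insertMinSum (λ w → h (w ++ 𝐛 ∷ [])) x +ω newBA ∎
    where
    front = h (𝐚 ∷ x ++ 𝐛 ∷ [])
    inside = ∑[ w ∈ betweenEntries x ] h (w ++ 𝐛 ∷ [])
    newBA = h (x ++ 𝐛 ∷ 𝐚 ∷ [])
    newBB = h (x ++ 𝐛 ∷ 𝐛 ∷ [])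

  insertMin-junction : ∀ x y → insertMinSum h (x ++ 𝐛 ∷ 𝐚 ∷ y) ≡
    insertMinSum (λ w → h (w ++ 𝐛 ∷ 𝐚 ∷ y)) x +ω insertMinSum (λ w → h (x ++ 𝐛 ∷ 𝐚 ∷ w)) y
  insertMin-junction x y = begin
    front +ω ∑ (afterEntries (x ++ 𝐛 ∷ 𝐚 ∷ y)) h
      ≡⟨ cong (front +ω_) (∑-afterEntries-++ x (𝐛 ∷ 𝐚 ∷ y) h) ⟩
    front +ω (inside +ω (newBA +ω (newBB +ω ∑ (map (𝐛 ∷_) (map (𝐚 ∷_) (afterEntries y))) (λ w → h (x ++ w)))))
      ≡⟨ cong (λ t → front +ω (inside +ω (newBA +ω (newBB +ω t)))) (trans (∑-map (𝐛 ∷_) (map (𝐚 ∷_) (afterEntries y)) (λ w → h (x ++ w)))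
                                                          (∑-map (𝐚 ∷_) (afterEntries y) (λ w → h (x ++ 𝐛 ∷ w)))) ⟩
    front +ω (inside +ω (newBA +ω (newBB +ω right)))
      ≡⟨ solve 5 (λ A B C D F → A ⊕ (B ⊕ (C ⊕ (D ⊕ F))) ⊜ (A ⊕ (B ⊕ (D ⊕ id))) ⊕ (C ⊕ F)) refl front inside newBA newBB right ⟩
    (front +ω (inside +ω (newBB +ω 0ω))) +ω (newBA +ω right)
      ≡⟨ cong (λ t → (front +ω (inside +ω (h t +ω 0ω))) +ω (newBA +ω right)) (List.++-assoc x (𝐛 ∷ []) (𝐛 ∷ 𝐚 ∷ y)) ⟨
    (front +ω (inside +ω (h ((x ++ 𝐛 ∷ []) ++ 𝐛 ∷ 𝐚 ∷ y) +ω 0ω))) +ω (newBA +ω right)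
      ≡⟨ cong (λ t → (front +ω t) +ω (newBA +ω right)) (∑-afterEntries x (λ w → h (w ++ 𝐛 ∷ 𝐚 ∷ y))) ⟨
    insertMinSum (λ w → h (w ++ 𝐛 ∷ 𝐚 ∷ y)) x +ω insertMinSum (λ w → h (x ++ 𝐛 ∷ 𝐚 ∷ w)) y ∎
    where
    front = h (𝐚 ∷ x ++ 𝐛 ∷ 𝐚 ∷ y)
    inside = ∑[ w ∈ betweenEntries x ] h (w ++ 𝐛 ∷ 𝐚 ∷ y)
    newBA = h (x ++ 𝐛 ∷ 𝐚 ∷ 𝐚 ∷ y)
    newBB = h (x ++ 𝐛 ∷ 𝐛 ∷ 𝐚 ∷ y)
    right = ∑[ w ∈ afterEntries y ] h (x ++ 𝐛 ∷ 𝐚 ∷ w)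

-- The sum over permutations of size k + 1 + m whose minimum 0 sits at position k + 1:
-- h at the descent word x⋯ba⋯y (ba around the minimum), x and y running over the
-- descent words of the parts before and after it, each part relabelled as a permutation.
splitSum : ℕ → ℕ → (List AB → ℤω) → ℤω
splitSum zero zero h = h []
splitSum zero (suc m) h = descentSum (suc m) (λ y → h (𝐚 ∷ y))
splitSum (suc k) zero h = descentSum (suc k) (λ x → h (x ++ 𝐛 ∷ []))
splitSum (suc k) (suc m) h = descentSum (suc k) (λ x → descentSum (suc m) (λ y → h (x ++ 𝐛 ∷ 𝐚 ∷ y)))

descentSum-cong : ∀ n {f g : List AB → ℤω} → (∀ u → f u ≡ g u) → descentSum n f ≡ descentSum n g
descentSum-cong n e = ∑-cong (permsByInsertion n) (λ l → e (descWord l))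

descentSum-+ : ∀ n (f g : List AB → ℤω) → descentSum n (λ u → f u +ω g u) ≡ descentSum n f +ω descentSum n g
descentSum-+ n f g = ∑-+ (permsByInsertion n) (λ l → f (descWord l)) (λ l → g (descWord l))

-- Leibniz rule: a new minimum is inserted either into the part before or after the old one.
leibniz : ∀ k m h → splitSum k m (insertMinSum h) ≡ splitSum (suc k) m h +ω splitSum k (suc m) h
leibniz zero zero h = solve 2 (λ A B → A ⊕ (B ⊕ id) ⊜ (B ⊕ id) ⊕ (A ⊕ id)) refl (h (𝐚 ∷ [])) (h (𝐛 ∷ []))
  where open CommMonoidSolver +-commutativeMonoid using (solve; _⊕_; _⊜_; id)
leibniz zero (suc m) h = begin
  descentSum (suc m) (λ y → insertMinSum h (𝐚 ∷ y))
    ≡⟨ descentSum-cong (suc m) (insertMin-front h) ⟩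
  descentSum (suc m) (λ y → h (𝐛 ∷ 𝐚 ∷ y) +ω insertMinSum (λ w → h (𝐚 ∷ w)) y)
    ≡⟨ descentSum-+ (suc m) (λ y → h (𝐛 ∷ 𝐚 ∷ y)) (insertMinSum (λ w → h (𝐚 ∷ w))) ⟩
  descentSum (suc m) (λ y → h (𝐛 ∷ 𝐚 ∷ y)) +ω descentSum (suc m) (insertMinSum (λ w → h (𝐚 ∷ w)))
    ≡⟨ cong₂ _+ω_ (sym (+-identityʳ (descentSum (suc m) (λ y → h (𝐛 ∷ 𝐚 ∷ y))))) (sym (descentSum-step m (λ w → h (𝐚 ∷ w)))) ⟩
  splitSum 1 (suc m) h +ω splitSum zero (suc (suc m)) h ∎
  where open ≡-Reasoning
leibniz (suc k) zero h = begin
  descentSum (suc k) (λ x → insertMinSum h (x ++ 𝐛 ∷ []))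
    ≡⟨ descentSum-cong (suc k) (insertMin-end h) ⟩
  descentSum (suc k) (λ x → insertMinSum (λ w → h (w ++ 𝐛 ∷ [])) x +ω h (x ++ 𝐛 ∷ 𝐚 ∷ []))
    ≡⟨ descentSum-+ (suc k) (insertMinSum (λ w → h (w ++ 𝐛 ∷ []))) (λ x → h (x ++ 𝐛 ∷ 𝐚 ∷ [])) ⟩
  descentSum (suc k) (insertMinSum (λ w → h (w ++ 𝐛 ∷ []))) +ω descentSum (suc k) (λ x → h (x ++ 𝐛 ∷ 𝐚 ∷ []))
    ≡⟨ cong₂ _+ω_ (sym (descentSum-step k (λ w → h (w ++ 𝐛 ∷ []))))
                  (descentSum-cong (suc k) (λ x → sym (+-identityʳ (h (x ++ 𝐛 ∷ 𝐚 ∷ []))))) ⟩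
  splitSum (suc (suc k)) zero h +ω splitSum (suc k) 1 h ∎
  where open ≡-Reasoning
leibniz (suc k) (suc m) h = begin
  descentSum (suc k) (λ x → descentSum (suc m) (λ y → insertMinSum h (x ++ 𝐛 ∷ 𝐚 ∷ y)))
    ≡⟨ descentSum-cong (suc k) (λ x → descentSum-cong (suc m) (insertMin-junction h x)) ⟩
  descentSum (suc k) (λ x → descentSum (suc m) (λ y → left x y +ω right x y))
    ≡⟨ descentSum-cong (suc k) (λ x → descentSum-+ (suc m) (left x) (right x)) ⟩
  descentSum (suc k) (λ x → descentSum (suc m) (left x) +ω descentSum (suc m) (right x))
    ≡⟨ descentSum-+ (suc k) (λ x → descentSum (suc m) (left x)) (λ x → descentSum (suc m) (right x)) ⟩
  descentSum (suc k) (λ x → descentSum (suc m) (left x)) +ω descentSum (suc k) (λ x → descentSum (suc m) (right x))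
    ≡⟨ cong₂ _+ω_ left-part (descentSum-cong (suc k) (λ x → sym (descentSum-step m (λ w → h (x ++ 𝐛 ∷ 𝐚 ∷ w))))) ⟩
  splitSum (suc (suc k)) (suc m) h +ω splitSum (suc k) (suc (suc m)) h ∎
  where
  open ≡-Reasoning
  left right : List AB → List AB → ℤω
  left x y = insertMinSum (λ w → h (w ++ 𝐛 ∷ 𝐚 ∷ y)) x
  right x y = insertMinSum (λ w → h (x ++ 𝐛 ∷ 𝐚 ∷ w)) y
  left-part : descentSum (suc k) (λ x → descentSum (suc m) (left x)) ≡ splitSum (suc (suc k)) (suc m) h
  left-part = trans (descentSum-cong (suc k) (λ x → ∑-swap (permsByInsertion (suc m)) (insertMin x) (λ l w → h (w ++ 𝐛 ∷ 𝐚 ∷ descWord l))))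
                    (sym (descentSum-step k (λ w → descentSum (suc m) (λ y → h (w ++ 𝐛 ∷ 𝐚 ∷ y)))))

-- pascal n F = ∑_{k+m=n} C(n,k) F k m, unfolded by Pascal's rule.
pascal : ℕ → (ℕ → ℕ → ℤω) → ℤω
pascal zero F = F 0 0
pascal (suc n) F = pascal n (λ k m → F (suc k) m +ω F k (suc m))

pascal-cong : ∀ n {F G : ℕ → ℕ → ℤω} → (∀ k m → k + m ≡ n → F k m ≡ G k m) → pascal n F ≡ pascal n G
pascal-cong zero e = e 0 0 refl
pascal-cong (suc n) e = pascal-cong n (λ k m k+m≡n →
  cong₂ _+ω_ (e (suc k) m (cong suc k+m≡n)) (e k (suc m) (trans (ℕ.+-suc k m) (cong suc k+m≡n))))

pascal-+ : ∀ n (F G : ℕ → ℕ → ℤω) → pascal n (λ k m → F k m +ω G k m) ≡ pascal n F +ω pascal n G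
pascal-+ zero F G = refl
pascal-+ (suc n) F G = trans (pascal-cong n (λ k m _ → +-interchange (F (suc k) m) (G (suc k) m) (F k (suc m)) (G k (suc m))))
  (pascal-+ n (λ k m → F (suc k) m +ω F k (suc m)) (λ k m → G (suc k) m +ω G k (suc m)))

-- The binomial coefficients are symmetric, so antisymmetric terms cancel.
pascal-antisymmetric : ∀ n (F : ℕ → ℕ → ℤω) → pascal n (λ k m → F k m +ω -ω F m k) ≡ 0ω
pascal-antisymmetric zero F = -‿inverseʳ (F 0 0)
pascal-antisymmetric (suc n) F = trans (pascal-cong n (λ k m _ → regroup (F (suc k) m) (F m (suc k)) (F k (suc m)) (F (suc m) k)))
  (pascal-antisymmetric n (λ k m → F (suc k) m +ω F k (suc m)))
  where
  open AbelianGroupProps +-abelianGroup using (⁻¹-anti-homo-∙)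
  regroup : ∀ a b c d → (a +ω -ω b) +ω (c +ω -ω d) ≡ (a +ω c) +ω -ω (d +ω b)
  regroup a b c d = trans (+-interchange a (-ω b) c (-ω d)) (cong (a +ω c +ω_) (sym (⁻¹-anti-homo-∙ d b)))

-- Sorting permutations by the position of their minimum.
descentSum-split : ∀ n h → descentSum (suc n) h ≡ pascal n (λ k m → splitSum k m h)
descentSum-split zero h = +-identityʳ (h [])
descentSum-split (suc n) h = trans (descentSum-step n h)
  (trans (descentSum-split n (insertMinSum h)) (pascal-cong n (λ k m _ → leibniz k m h)))

-- The weight L(u) = u(ω, ω̄) is multiplicative across the junction ba of a minimum, as ω̄ω = 1.
L : List AB → ℤω
L = wordValue abValue

L-junction : ∀ x y → L (x ++ 𝐛 ∷ 𝐚 ∷ y) ≡ L x *ω L y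
L-junction x y = trans (wordValue-++ abValue x (𝐛 ∷ 𝐚 ∷ y))
  (cong (L x *ω_) (trans (sym (*-assoc ω̄ ω (L y))) (*-identityˡ (L y))))

noBB : List AB → Bool
noBB [] = true
noBB (𝐚 ∷ u) = noBB u
noBB (𝐛 ∷ []) = true
noBB (𝐛 ∷ 𝐚 ∷ u) = noBB (𝐚 ∷ u)
noBB (𝐛 ∷ 𝐛 ∷ u) = false

notEndingInB : List AB → Bool
notEndingInB (c ∷ d ∷ u) = notEndingInB (d ∷ u)
notEndingInB (𝐚 ∷ []) = true
notEndingInB (𝐛 ∷ []) = false
notEndingInB [] = true

isRWord : List AB → Bool
isRWord u = noBB u ∧ notEndingInB u

isR-descWord : ∀ l → isR l ≡ isRWord (descWord l)
isR-descWord l = cong₂ _∧_ (noDoubleDescent-descWord l) (notEndingInDescent-descWord l)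
  where
  noDoubleDescent-descWord : ∀ l → noDoubleDescent l ≡ noBB (descWord l)
  noDoubleDescent-descWord [] = refl
  noDoubleDescent-descWord (x ∷ []) = refl
  noDoubleDescent-descWord (x ∷ y ∷ []) with y <ᵇ x
  ... | true = refl
  ... | false = refl
  noDoubleDescent-descWord (x ∷ y ∷ z ∷ r) with y <ᵇ x | z <ᵇ y | noDoubleDescent-descWord (y ∷ z ∷ r)
  ... | true | true | _ = refl
  ... | true | false | ih = ih
  ... | false | _ | ih = ih
  notEndingInDescent-descWord : ∀ l → notEndingInDescent l ≡ notEndingInB (descWord l)
  notEndingInDescent-descWord [] = refl
  notEndingInDescent-descWord (x ∷ []) = refl
  notEndingInDescent-descWord (x ∷ y ∷ []) with y <ᵇ x
  ... | true = refl
  ... | false = refl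
  notEndingInDescent-descWord (x ∷ y ∷ z ∷ r) = notEndingInDescent-descWord (y ∷ z ∷ r)

notEndingInB-front : ∀ y → notEndingInB (𝐚 ∷ y) ≡ notEndingInB y
notEndingInB-front [] = refl
notEndingInB-front (c ∷ y) = refl

isRWord-front : ∀ y → isRWord (𝐚 ∷ y) ≡ isRWord y
isRWord-front y = cong (noBB y ∧_) (notEndingInB-front y)

isRWord-end : ∀ x → isRWord (x ++ 𝐛 ∷ []) ≡ false
isRWord-end x = trans (cong (noBB (x ++ 𝐛 ∷ []) ∧_) (endsInB x)) (Bool.∧-zeroʳ (noBB (x ++ 𝐛 ∷ [])))
  where
  endsInB : ∀ x → notEndingInB (x ++ 𝐛 ∷ []) ≡ false
  endsInB [] = refl
  endsInB (c ∷ []) = refl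
  endsInB (c ∷ d ∷ x) = endsInB (d ∷ x)

isRWord-junction : ∀ x y → isRWord (x ++ 𝐛 ∷ 𝐚 ∷ y) ≡ isRWord x ∧ isRWord y
isRWord-junction x y = trans (cong₂ _∧_ (noBB-junction x y) (notEndingInB-junction x y))
                             (Bool.∧-assoc (noBB x ∧ notEndingInB x) (noBB y) (notEndingInB y))
  where
  noBB-junction : ∀ x y → noBB (x ++ 𝐛 ∷ 𝐚 ∷ y) ≡ isRWord x ∧ noBB y
  noBB-junction [] y = refl
  noBB-junction (𝐚 ∷ []) y = refl
  noBB-junction (𝐚 ∷ c ∷ x) y = noBB-junction (c ∷ x) y
  noBB-junction (𝐛 ∷ []) y = refl
  noBB-junction (𝐛 ∷ 𝐚 ∷ x) y = noBB-junction (𝐚 ∷ x) y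
  noBB-junction (𝐛 ∷ 𝐛 ∷ x) y = refl
  notEndingInB-junction : ∀ x y → notEndingInB (x ++ 𝐛 ∷ 𝐚 ∷ y) ≡ notEndingInB y
  notEndingInB-junction [] y = notEndingInB-front y
  notEndingInB-junction (c ∷ []) y = notEndingInB-front y
  notEndingInB-junction (c ∷ d ∷ x) y = notEndingInB-junction (d ∷ x) y

⟦_⟧ : Bool → ℤω
⟦ b ⟧ = if b then 1ω else 0ω

K : List AB → ℤω
K u = ⟦ isRWord u ⟧

K-junction : ∀ x y → K (x ++ 𝐛 ∷ 𝐚 ∷ y) ≡ K x *ω K y
K-junction x y = trans (cong ⟦_⟧ (isRWord-junction x y)) (⟦∧⟧ (isRWord x) (isRWord y))
  where
  ⟦∧⟧ : ∀ p q → ⟦ p ∧ q ⟧ ≡ ⟦ p ⟧ *ω ⟦ q ⟧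
  ⟦∧⟧ true true = refl
  ⟦∧⟧ true false = refl
  ⟦∧⟧ false q = refl

splitSum-product : ∀ k m (f : List AB → ℤω) → (∀ x y → f (x ++ 𝐛 ∷ 𝐚 ∷ y) ≡ f x *ω f y) →
                   splitSum (suc k) (suc m) f ≡ descentSum (suc k) f *ω descentSum (suc m) f
splitSum-product k m f f-junction = trans
  (descentSum-cong (suc k) (λ x → trans (descentSum-cong (suc m) (f-junction x)) (∑-*ˡ (permsByInsertion (suc m)) (f x) (λ l → f (descWord l)))))
  (∑-*ʳ (permsByInsertion (suc k)) (descentSum (suc m) f) (λ l → f (descWord l)))

splitSum-L-front : ∀ m → splitSum zero (suc m) L ≡ ω *ω descentSum (suc m) L
splitSum-L-front m = ∑-*ˡ (permsByInsertion (suc m)) ω (λ l → L (descWord l))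

splitSum-L-end : ∀ k → splitSum (suc k) zero L ≡ descentSum (suc k) L *ω ω̄
splitSum-L-end k = trans (descentSum-cong (suc k) (λ x → trans (wordValue-++ abValue x (𝐛 ∷ [])) (cong (L x *ω_) (*-identityʳ ω̄))))
                         (∑-*ʳ (permsByInsertion (suc k)) ω̄ (λ l → L (descWord l)))

splitSum-K-front : ∀ m → splitSum zero (suc m) K ≡ descentSum (suc m) K
splitSum-K-front m = descentSum-cong (suc m) (λ y → cong ⟦_⟧ (isRWord-front y))

splitSum-K-end : ∀ k → splitSum (suc k) zero K ≡ 0ω
splitSum-K-end k = trans (descentSum-cong (suc k) (λ x → cong ⟦_⟧ (isRWord-end x))) (∑-0 (permsByInsertion (suc k)))

-- ω = 1 − ω̄, and ω̄ commutes, written in the shape needed below.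
ω-front : ∀ s → ω *ω s ≡ s +ω (0ω +ω -ω (ω̄ *ω s))
ω-front (mk a b) = cong₂ mk (re a b) (im a b)
  where
  re : ∀ a b → + 0 *ℤ a +ℤ - (+ 1 *ℤ b) ≡ a +ℤ (+ 0 +ℤ - (+ 1 *ℤ a +ℤ - (- (+ 1) *ℤ b)))
  re = solve-∀
  im : ∀ a b → + 0 *ℤ b +ℤ + 1 *ℤ a +ℤ + 1 *ℤ b ≡ b +ℤ (+ 0 +ℤ - (+ 1 *ℤ b +ℤ - (+ 1) *ℤ a +ℤ - (+ 1) *ℤ b))
  im = solve-∀

ω̄-end : ∀ s → s *ω ω̄ ≡ 0ω +ω (ω̄ *ω s +ω -ω 0ω)
ω̄-end s = trans (*-comm s ω̄) (sym (trans (+-identityˡ (ω̄ *ω s +ω 0ω)) (+-identityʳ (ω̄ *ω s))))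

boundary : ℕ → ℕ → ℤω
boundary (suc k) zero = ω̄ *ω descentSum (suc k) L
boundary _ _ = 0ω

correction : ℕ → ℕ → ℤω
correction k m = boundary k m +ω -ω boundary m k

splitSum-L-K : ∀ n → (∀ {j} → j < n → descentSum (suc j) L ≡ descentSum (suc j) K) →
               ∀ k m → k + m ≡ n → splitSum k m L ≡ splitSum k m K +ω correction k m
splitSum-L-K n smaller zero zero _ = refl
splitSum-L-K n smaller zero (suc m) refl = begin
  splitSum zero (suc m) L                            ≡⟨ splitSum-L-front m ⟩
  ω *ω descentSum (suc m) L                          ≡⟨ ω-front (descentSum (suc m) L) ⟩
  descentSum (suc m) L +ω correction zero (suc m)    ≡⟨ cong (_+ω correction zero (suc m)) (smaller ℕ.≤-refl) ⟩
  descentSum (suc m) K +ω correction zero (suc m)    ≡⟨ cong (_+ω correction zero (suc m)) (splitSum-K-front m) ⟨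
  splitSum zero (suc m) K +ω correction zero (suc m) ∎
  where open ≡-Reasoning
splitSum-L-K n smaller (suc k) zero _ = begin
  splitSum (suc k) zero L                            ≡⟨ splitSum-L-end k ⟩
  descentSum (suc k) L *ω ω̄                          ≡⟨ ω̄-end (descentSum (suc k) L) ⟩
  0ω +ω correction (suc k) zero                      ≡⟨ cong (_+ω correction (suc k) zero) (splitSum-K-end k) ⟨
  splitSum (suc k) zero K +ω correction (suc k) zero ∎
  where open ≡-Reasoning
splitSum-L-K n smaller (suc k) (suc m) refl = begin
  splitSum (suc k) (suc m) L                         ≡⟨ splitSum-product k m L L-junction ⟩
  descentSum (suc k) L *ω descentSum (suc m) L       ≡⟨ cong₂ _*ω_ (smaller (s≤s (ℕ.m≤m+n k (suc m))))
                                                                   (smaller (s≤s (ℕ.≤-trans (ℕ.n≤1+n m) (ℕ.m≤n+m (suc m) k)))) ⟩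
  descentSum (suc k) K *ω descentSum (suc m) K       ≡⟨ splitSum-product k m K K-junction ⟨
  splitSum (suc k) (suc m) K                         ≡⟨ +-identityʳ (splitSum (suc k) (suc m) K) ⟨
  splitSum (suc k) (suc m) K +ω 0ω ∎
  where open ≡-Reasoning

-- The sums of L and K over the descent words of all permutations of each size agree, by
-- strong induction: sort by the position of the minimum and let pascal kill the corrections.
L≡K : ∀ n → descentSum (suc n) L ≡ descentSum (suc n) K
L≡K = <-rec _ λ n smaller → begin
  descentSum (suc n) L                                      ≡⟨ descentSum-split n L ⟩
  pascal n (λ k m → splitSum k m L)                         ≡⟨ pascal-cong n (splitSum-L-K n smaller) ⟩
  pascal n (λ k m → splitSum k m K +ω correction k m)       ≡⟨ pascal-+ n (λ k m → splitSum k m K) correction ⟩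
  pascal n (λ k m → splitSum k m K) +ω pascal n correction  ≡⟨ cong (pascal n (λ k m → splitSum k m K) +ω_)
                                                                    (pascal-antisymmetric n boundary) ⟩
  pascal n (λ k m → splitSum k m K) +ω 0ω                   ≡⟨ +-identityʳ (pascal n (λ k m → splitSum k m K)) ⟩
  pascal n (λ k m → splitSum k m K)                         ≡⟨ descentSum-split n K ⟨
  descentSum (suc n) K ∎
  where open ≡-Reasoning

Rcount-∑ : ∀ n → emb (+ Rcount n) ≡ ∑[ σ ∈ perms n ] K (descentWord σ)
Rcount-∑ n = trans (length-filter (λ σ → isR (permList σ) Bool.≟ true) (perms n))
  (∑-cong (perms n) (λ σ → trans (indicator (isR (permList σ))) (cong ⟦_⟧ (isR-descWord (permList σ)))))
  where
  indicator : ∀ b → 𝟙 (b Bool.≟ true) ≡ ⟦ b ⟧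
  indicator true = refl
  indicator false = refl

c,d-values : ∀ x → eval (λ _ → 1ω) (hatMinusSub x) ≡ eval abValue (abSub x)
c,d-values 𝐜 = refl
c,d-values 𝐝 = refl

theorem7p6 : (n : ℕ) → 1 ≤ n → (Φ : Poly CD) → IsCdIndex n Φ →
    coeffSum (subst hatMinusSub Φ) ≡ + Rcount n
theorem7p6 (suc n) (s≤s z≤n) Φ isCd = cong ℤω.re (begin
  emb (coeffSum (subst hatMinusSub Φ))              ≡⟨ coeffSum-eval (subst hatMinusSub Φ) ⟩
  eval (λ _ → 1ω) (subst hatMinusSub Φ)             ≡⟨ eval-subst hatMinusSub (λ _ → 1ω) Φ ⟩
  eval (λ x → eval (λ _ → 1ω) (hatMinusSub x)) Φ    ≡⟨ eval-cong c,d-values Φ ⟩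
  eval (λ x → eval abValue (abSub x)) Φ             ≡⟨ eval-subst abSub abValue Φ ⟨
  eval abValue (subst abSub Φ)                      ≡⟨ Ψ-value (suc n) Φ isCd ⟩
  ∑[ σ ∈ perms (suc n) ] L (descentWord σ)         ≡⟨ perms-sum (suc n) (λ l → L (descWord l)) ⟩
  descentSum (suc n) L                              ≡⟨ L≡K n ⟩
  descentSum (suc n) K                              ≡⟨ perms-sum (suc n) (λ l → K (descWord l)) ⟨
  ∑[ σ ∈ perms (suc n) ] K (descentWord σ)         ≡⟨ Rcount-∑ (suc n) ⟨
  emb (+ Rcount (suc n)) ∎)
  where open ≡-Reasoning
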